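{- There are infinitely many (connected) graphs $G$ of order $n$ with $\omega(G)<\chi(G)$ for which $\overline{\mathrm{scs}}(G)=n-2$.
   Context: $\omega(G)$ is the clique number. For a graph $G=(V,E)$ and $k=\chi(G)$, a proper $k$-colouring is a map $c\colon V\to\{1,\dots,k\}$ with adjacent vertices receiving different colours. A determining set for $(G,c)$ is a set $S\subseteq V$ such that no proper $k$-colouring $c'\neq c$ satisfies $c'(s)=c(s)$ for all $s\in S$; a critical set is an inclusion-minimal determining set; $\mathrm{scs}(G,c)$ is the minimum size of a critical set for $(G,c)$; $\overline{\mathrm{scs}}(G)$ is the maximum of $\mathrm{scs}(G,c)$ over all proper $\chi(G)$-colourings $c$. -}

module Defs where

open import Data.Nat using (ℕ; _≤_)
open import Data.Fin using (Fin)
open import Data.Fin.Subset using (Subset; _∈_; _⊂_; ∣_∣)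
open import Data.Product using (Σ; ∃; _×_; _,_)
open import Relation.Nullary using (¬_)
open import Relation.Binary.PropositionalEquality using (_≡_)

record Graph (n : ℕ) : Set₁ where
  field
    Adj     : Fin n → Fin n → Set
    symm    : ∀ {u v} → Adj u v → Adj v u
    irrefl  : ∀ {u} → ¬ Adj u u
open Graph public

data Reachable {n : ℕ} (G : Graph n) : Fin n → Fin n → Set where
  here : ∀ {u} → Reachable G u u
  step : ∀ {u v w} → Adj G u v → Reachable G v w → Reachable G u w

Connected : ∀ {n} → Graph n → Set
Connected G = ∀ u v → Reachable G u v

IsClique : ∀ {n} → Graph n → Subset n → Set
IsClique G K = ∀ u v → u ∈ K → v ∈ K → ¬ (u ≡ v) → Adj G u v

IsCliqueNumber : ∀ {n} → Graph n → ℕ → Set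
IsCliqueNumber G w =
  (Σ _ λ K → IsClique G K × ∣ K ∣ ≡ w) × (∀ K → IsClique G K → ∣ K ∣ ≤ w)

Colouring : ℕ → ℕ → Set
Colouring n k = Fin n → Fin k

Proper : ∀ {n k} → Graph n → Colouring n k → Set
Proper G c = ∀ u v → Adj G u v → ¬ (c u ≡ c v)

Colourable : ∀ {n} → Graph n → ℕ → Set
Colourable {n} G k = Σ (Colouring n k) λ c → Proper G c

IsChromaticNumber : ∀ {n} → Graph n → ℕ → Set
IsChromaticNumber G k = Colourable G k × (∀ j → Colourable G j → k ≤ j)

Determining : ∀ {n k} → Graph n → Colouring n k → Subset n → Set
Determining {n} {k} G c S =
  ∀ (c' : Colouring n k) → Proper G c' →
    (∀ s → s ∈ S → c' s ≡ c s) → ∀ v → c' v ≡ c v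

Critical : ∀ {n k} → Graph n → Colouring n k → Subset n → Set
Critical G c S = Determining G c S × (∀ T → T ⊂ S → ¬ Determining G c T)

IsSCS : ∀ {n k} → Graph n → Colouring n k → ℕ → Set
IsSCS G c m =
  (Σ _ λ S → Critical G c S × ∣ S ∣ ≡ m) × (∀ S → Critical G c S → m ≤ ∣ S ∣)

-- scs‾(G) = v, where k is the chromatic number of G: v is the maximum of
-- scs(G,c) over all proper k-colourings c.
IsMaxSCS : ∀ {n} → Graph n → ℕ → ℕ → Set
IsMaxSCS {n} G k v =
  (Σ (Colouring n k) λ c → Proper G c × IsSCS G c v)
  × (∀ (c : Colouring n k) → Proper G c → ∀ m → IsSCS G c m → m ≤ v)

{-# OPTIONS --safe #-}
module Submission where

-- The graph is the 5-cycle with p pendant vertices attached to one cycle vertex, so n = 5 + p,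
-- ω = 2 and χ = 3. Since every determining set contains a critical set (delete vertices while the
-- set stays determining), scs(G,c) is the least size of a determining set.
--
-- Upper bound: some cycle vertex s carries a colour used only once on the cycle. The pendants
-- together with s, s+2 and s+3 determine c, because s+1 and s+4 each see two different colours
-- among them, which leaves a single possible colour.
--
-- Lower bound: colour the cycle 0,1,0,1,2 and every pendant 1. The pendants and the cycle
-- vertices 1 and 2 can each be recoloured 2 on its own, and swapping the colours of 3 and 4 gives
-- another proper colouring, so a determining set contains all of these and one of 3, 4: that is
-- at least p + 3 = n − 2 vertices.

open import Defs
open import Data.Nat using (ℕ; zero; suc; _≤_; _<_; _≤?_; _∸_; _+_; s≤s)
open import Data.Nat.Properties
  using (≤-refl; ≤-reflexive; ≤-trans; ≤-antisym; ≤-pred; ≰⇒>; m≤n+m) renaming (_≟_ to _≟ℕ_)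
open import Data.Nat.Induction using (<-wellFounded)
open import Data.Product using (Σ; ∃; ∃₂; _×_; _,_; proj₁; proj₂)
open import Data.Sum using (_⊎_; inj₁; inj₂)
open import Data.Bool using (Bool; true; false; T; _∨_)
open import Data.Bool.Properties using (∨-comm)
open import Data.Empty using (⊥-elim)
open import Data.Fin using (Fin; zero; suc; toℕ; #_; inject≤; _↑ˡ_; _↑ʳ_)
open import Data.Fin.Properties using (_≟_; all?; any?; inject≤-injective; suc-injective)
open import Data.Fin.Subset using (Subset; _∈_; _∉_; _⊆_; ∣_∣; ⁅_⁆; _∪_; _-_; ⊤; ⊥)
open import Data.Fin.Subset.Properties
  using (_∈?_; ⊆-refl; ⊆-trans; p─q⊆p; x∈p∧x≢y⇒x∈p-y; x∈p⇒∣p-x∣<∣p∣; p⊆q⇒∣p∣≤∣q∣;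
         x∈⁅x⁆; x∈⁅y⁆⇒x≡y; x∈p∪q⁻; ∪-identityˡ; ∈⊤; ∣⊤∣≡n; ∣⊥∣≡0)
open import Data.Vec using ([]; _∷_; _++_; lookup; here; there)
open import Data.Vec.Properties using (lookup-++ˡ; lookup-++ʳ; []=⇒lookup; lookup⇒[]=)
import Data.Vec.Functional as Vector
open import Data.Vec.Functional.Properties using (updateAt-updates; updateAt-minimal)
open import Function using (_∘_)
open import Function.Definitions using (Injective)
open import Induction.WellFounded using (Acc; acc)
open import Relation.Nullary using (¬_; Dec; yes; no)
open import Relation.Nullary.Decidable
  using (from-yes; True; toWitness; T?; ¬?; _×-dec_; _⊎-dec_; _→-dec_; map′)
open import Relation.Binary.PropositionalEquality
  using (_≡_; _≢_; _≗_; refl; sym; trans; cong; cong₂; subst)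

all-colourings? : ∀ {n k} {P : Colouring n k → Set} →
  (∀ {c c'} → c ≗ c' → P c → P c') → (∀ c → Dec (P c)) → Dec (∀ c → P c)
all-colourings? {zero} resp P? = map′ (λ p c → resp (λ ()) p) (λ h → h _) (P? (λ ()))
all-colourings? {suc n} resp P? =
  map′ (λ h c → resp (λ { zero → refl ; (suc i) → refl }) (h (c zero) (Vector.tail c)))
       (λ h x c → h (x Vector.∷ c))
       (all? λ x → all-colourings? (λ eq → resp (λ { zero → refl ; (suc i) → eq i }))
                                    (λ c → P? (x Vector.∷ c)))

third-colour-unique : ∀ {a b x y : Fin 3} → a ≢ b → x ≢ a → x ≢ b → y ≢ a → y ≢ b → x ≡ y
third-colour-unique {a} {b} {x} {y} = from-yes (all? λ (a : Fin 3) → all? λ b → all? λ x → all? λ y →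
  ¬? (a ≟ b) →-dec ¬? (x ≟ a) →-dec ¬? (x ≟ b) →-dec ¬? (y ≟ a) →-dec ¬? (y ≟ b) →-dec x ≟ y)
  a b x y

∣++∣ : ∀ {a b} (p : Subset a) (q : Subset b) → ∣ p ++ q ∣ ≡ ∣ p ∣ + ∣ q ∣
∣++∣ []          q = refl
∣++∣ (true ∷ p)  q = cong suc (∣++∣ p q)
∣++∣ (false ∷ p) q = ∣++∣ p q

members-injection : ∀ {m n} (p : Subset n) → m ≤ ∣ p ∣ →
  ∃ λ (f : Fin m → Fin n) → Injective _≡_ _≡_ f × (∀ i → f i ∈ p)
members-injection {zero} p _ = (λ ()) , (λ { {()} }) , λ ()
members-injection {suc m} {suc n} (true ∷ p) (s≤s m≤∣p∣) with members-injection p m≤∣p∣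
... | f , injective , f∈p = g , g-injective , λ { zero → here ; (suc i) → there (f∈p i) }
  where
  g : Fin (suc m) → Fin (suc n)
  g = zero Vector.∷ (suc ∘ f)
  g-injective : Injective _≡_ _≡_ g
  g-injective {zero} {zero} _ = refl
  g-injective {suc i} {suc j} e = cong suc (injective (suc-injective e))
members-injection {suc m} (false ∷ p) m<∣p∣ with members-injection p m<∣p∣
... | f , injective , f∈p = suc ∘ f , injective ∘ suc-injective , there ∘ f∈p

module _ {n : ℕ} (G : Graph n) where

  proper? : ∀ {k} → (∀ u v → Dec (Adj G u v)) → (c : Colouring n k) → Dec (Proper G c)
  proper? adj? c = all? λ u → all? λ v → adj? u v →-dec ¬? (c u ≟ c v)

  determining-mono : ∀ {k} {c : Colouring n k} {S S'} → S ⊆ S' →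
    Determining G c S → Determining G c S'
  determining-mono S⊆S' det c' pc' agree = det c' pc' (λ s s∈S → agree s (S⊆S' s∈S))

  determining? : ∀ {k} → (∀ u v → Dec (Adj G u v)) → (c : Colouring n k) (S : Subset n) →
    Dec (Determining G c S)
  determining? adj? c S = all-colourings? resp λ c' →
    proper? adj? c' →-dec all? (λ s → s ∈? S →-dec c' s ≟ c s) →-dec all? (λ v → c' v ≟ c v)
    where
    resp : ∀ {c₁ c₂} → c₁ ≗ c₂ →
      (Proper G c₁ → (∀ s → s ∈ S → c₁ s ≡ c s) → ∀ v → c₁ v ≡ c v) →
      (Proper G c₂ → (∀ s → s ∈ S → c₂ s ≡ c s) → ∀ v → c₂ v ≡ c v)
    resp eq h pc₂ agree v = trans (sym (eq v)) (h
      (λ u w a e → pc₂ u w a (trans (sym (eq u)) (trans e (eq w))))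
      (λ s s∈S → trans (eq s) (agree s s∈S)) v)

  critical-subset : ∀ {k} {c : Colouring n k} {S} → (∀ u v → Dec (Adj G u v)) →
    Determining G c S → ∃ λ T → T ⊆ S × Critical G c T
  critical-subset {c = c} adj? = go _ (<-wellFounded _)
    where
    go : ∀ S → Acc _<_ ∣ S ∣ → Determining G c S → ∃ λ T → T ⊆ S × Critical G c T
    go S (acc smaller) det with any? (λ x → x ∈? S ×-dec determining? adj? c (S - x))
    ... | yes (x , x∈S , det-x) =
      let T , T⊆S-x , critical = go (S - x) (smaller (x∈p⇒∣p-x∣<∣p∣ x∈S)) det-x
      in T , ⊆-trans T⊆S-x (p─q⊆p S ⁅ x ⁆) , critical
    ... | no irremovable = S , ⊆-refl , det , λ where
      T (T⊆S , x , x∈S , x∉T) detT → irremovable (x , x∈S ,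
        determining-mono (λ y∈T → x∈p∧x≢y⇒x∈p-y (T⊆S y∈T) λ { refl → x∉T y∈T }) detT)

  determining-meets : ∀ {k} {c c' : Colouring n k} {S D w} → Determining G c S → Proper G c' →
    (∀ v → v ∉ D → c' v ≡ c v) → c' w ≢ c w → ∃ λ x → x ∈ S × x ∈ D
  determining-meets {c' = c'} {S} {D} {w} det pc' outside c'w≢cw
    with any? (λ x → x ∈? S ×-dec x ∈? D)
  ... | yes found = found
  ... | no none = ⊥-elim (c'w≢cw (det c' pc' (λ s s∈S → outside s (λ s∈D → none (s , s∈S , s∈D))) w))

  recolour : ∀ {k} → Colouring n k → Fin n → Fin k → Colouring n k
  recolour c v b = Vector.updateAt c v (λ _ → b)

  module _ {k} {c : Colouring n k} {v : Fin n} {b : Fin k} where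

    recolour-at : recolour c v b v ≡ b
    recolour-at = updateAt-updates v c

    recolour-elsewhere : ∀ {u} → u ≢ v → recolour c v b u ≡ c u
    recolour-elsewhere {u} u≢v = updateAt-minimal u v c u≢v

    recolour-proper : Proper G c → (∀ u → Adj G v u → c u ≢ b) → Proper G (recolour c v b)
    recolour-proper pc free u w a with u ≟ v | w ≟ v
    ... | yes refl | yes refl = ⊥-elim (irrefl G a)
    ... | yes refl | no w≢v = λ e →
      free w a (trans (sym (recolour-elsewhere w≢v)) (trans (sym e) recolour-at))
    ... | no u≢v | yes refl = λ e →
      free u (symm G a) (trans (sym (recolour-elsewhere u≢v)) (trans e recolour-at))
    ... | no u≢v | no w≢v = λ e →
      pc u w a (trans (sym (recolour-elsewhere u≢v)) (trans e (recolour-elsewhere w≢v)))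

    recolourable-∈ : ∀ {S} → Proper G c → b ≢ c v → (∀ u → Adj G v u → c u ≢ b) →
      Determining G c S → v ∈ S
    recolourable-∈ pc b≢cv free det
      with determining-meets det (recolour-proper pc free)
             (λ u u∉⁅v⁆ → recolour-elsewhere (λ { refl → u∉⁅v⁆ (x∈⁅x⁆ u) }))
             (λ e → b≢cv (trans (sym recolour-at) e))
    ... | x , x∈S , x∈⁅v⁆ = subst (_∈ _) (x∈⁅y⁆⇒x≡y v x∈⁅v⁆) x∈S

  SeesTwoColours : ∀ {k} → Colouring n k → Subset n → Fin n → Set
  SeesTwoColours c S v = ∃₂ λ u w → u ∈ S × w ∈ S × Adj G v u × Adj G v w × c u ≢ c w

  determining-if-others-see-two-colours : ∀ {c : Colouring n 3} {S} → Proper G c →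
    (∀ v → v ∈ S ⊎ SeesTwoColours c S v) → Determining G c S
  determining-if-others-see-two-colours pc cover c' pc' agree v with cover v
  ... | inj₁ v∈S = agree v v∈S
  ... | inj₂ (u , w , u∈S , w∈S , vu , vw , cu≢cw) = third-colour-unique cu≢cw
      (λ e → pc' v u vu (trans e (sym (agree u u∈S))))
      (λ e → pc' v w vw (trans e (sym (agree w w∈S))))
      (pc v u vu) (pc v w vw)

  module _ (adj? : ∀ u v → Dec (Adj G u v)) {k : ℕ} where

    scs≤∣determining∣ : ∀ {c : Colouring n k} {D m} → Determining G c D → IsSCS G c m → m ≤ ∣ D ∣
    scs≤∣determining∣ det (_ , minimum) =
      let T , T⊆D , critical = critical-subset adj? det
      in ≤-trans (minimum T critical) (p⊆q⇒∣p∣≤∣q∣ T⊆D)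

    isSCS-intro : ∀ {c : Colouring n k} {D m} → (∀ S → Determining G c S → m ≤ ∣ S ∣) →
      Determining G c D → ∣ D ∣ ≤ m → IsSCS G c m
    isSCS-intro lower det ∣D∣≤m =
      let T , T⊆D , critical = critical-subset adj? det
      in (T , critical , ≤-antisym (≤-trans (p⊆q⇒∣p∣≤∣q∣ T⊆D) ∣D∣≤m) (lower T (proj₁ critical)))
         , λ S critical → lower S (proj₁ critical)

    isMaxSCS-intro : ∀ {m} (c₀ : Colouring n k) → Proper G c₀ →
      (∀ S → Determining G c₀ S → m ≤ ∣ S ∣) →
      (∀ c → Proper G c → ∃ λ D → Determining G c D × ∣ D ∣ ≤ m) → IsMaxSCS G k m
    isMaxSCS-intro c₀ pc₀ lower small =
      (c₀ , pc₀ , let _ , det , ∣D∣≤m = small c₀ pc₀ in isSCS-intro lower det ∣D∣≤m)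
      , λ c pc _ scs → let _ , det , ∣D∣≤m = small c pc in ≤-trans (scs≤∣determining∣ det scs) ∣D∣≤m

  reachable-trans : ∀ {u v w} → Reachable G u v → Reachable G v w → Reachable G u w
  reachable-trans here        r = r
  reachable-trans (step a r₁) r = step a (reachable-trans r₁ r)

  reachable-sym : ∀ {u v} → Reachable G u v → Reachable G v u
  reachable-sym here       = here
  reachable-sym (step a r) = reachable-trans (reachable-sym r) (step (symm G a) here)

  connected-via : ∀ h → (∀ v → Reachable G v h) → Connected G
  connected-via h toHub u v = reachable-trans (toHub u) (reachable-sym (toHub v))

  colourable-mono : ∀ {j k} → j ≤ k → Colourable G j → Colourable G k
  colourable-mono j≤k (c , pc) =
    (λ v → inject≤ (c v) j≤k) , λ u v a e → pc u v a (inject≤-injective j≤k j≤k _ _ e)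

  clique≤2 : (∀ u v w → Adj G u v → Adj G v w → ¬ Adj G u w) →
    ∀ K → IsClique G K → ∣ K ∣ ≤ 2
  clique≤2 triangle-free K clique with 3 ≤? ∣ K ∣
  ... | no ¬3≤∣K∣ = ≤-pred (≰⇒> ¬3≤∣K∣)
  ... | yes 3≤∣K∣ =
    let f , injective , f∈K = members-injection K 3≤∣K∣
        edge : ∀ i j → i ≢ j → Adj G (f i) (f j)
        edge i j i≢j = clique (f i) (f j) (f∈K i) (f∈K j) (i≢j ∘ injective)
    in ⊥-elim (triangle-free _ _ _ (edge (# 0) (# 1) (λ ())) (edge (# 1) (# 2) (λ ())) (edge (# 0) (# 2) (λ ())))

  edge-isClique : ∀ {u v} → Adj G u v → IsClique G (⁅ u ⁆ ∪ ⁅ v ⁆)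
  edge-isClique {u} {v} uv x y x∈ y∈ x≢y
    with x∈p∪q⁻ ⁅ u ⁆ ⁅ v ⁆ x∈ | x∈p∪q⁻ ⁅ u ⁆ ⁅ v ⁆ y∈
  ... | inj₁ x∈⁅u⁆ | inj₁ y∈⁅u⁆ = ⊥-elim (x≢y (trans (x∈⁅y⁆⇒x≡y u x∈⁅u⁆) (sym (x∈⁅y⁆⇒x≡y u y∈⁅u⁆))))
  ... | inj₂ x∈⁅v⁆ | inj₂ y∈⁅v⁆ = ⊥-elim (x≢y (trans (x∈⁅y⁆⇒x≡y v x∈⁅v⁆) (sym (x∈⁅y⁆⇒x≡y v y∈⁅v⁆))))
  ... | inj₁ x∈⁅u⁆ | inj₂ y∈⁅v⁆ rewrite x∈⁅y⁆⇒x≡y u x∈⁅u⁆ | x∈⁅y⁆⇒x≡y v y∈⁅v⁆ = uv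
  ... | inj₂ x∈⁅v⁆ | inj₁ y∈⁅u⁆ rewrite x∈⁅y⁆⇒x≡y v x∈⁅v⁆ | x∈⁅y⁆⇒x≡y u y∈⁅u⁆ = symm G uv

preimage : ∀ {m n} → Graph m → (Fin n → Fin m) → Graph n
preimage H f = record { Adj = λ u v → Adj H (f u) (f v) ; symm = symm H ; irrefl = irrefl H }

link : ℕ → ℕ → Bool
link 0 1 = true
link 1 2 = true
link 2 3 = true
link 3 4 = true
link 4 0 = true
link 0 5 = true
link _ _ = false

pan : Graph 6
pan = record
  { Adj    = λ i j → T (link (toℕ i) (toℕ j) ∨ link (toℕ j) (toℕ i))
  ; symm   = λ {i} {j} → subst T (∨-comm (link (toℕ i) (toℕ j)) (link (toℕ j) (toℕ i)))
  ; irrefl = λ {i} → from-yes (all? λ (i : Fin 6) → ¬? (T? (link (toℕ i) (toℕ i) ∨ link (toℕ i) (toℕ i)))) i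
  }

pan-adj? : ∀ i j → Dec (Adj pan i j)
pan-adj? i j = T? _

pan-triangle-free : ∀ i j l → Adj pan i j → Adj pan j l → ¬ Adj pan i l
pan-triangle-free = from-yes (all? λ i → all? λ j → all? λ l →
  pan-adj? i j →-dec pan-adj? j l →-dec ¬? (pan-adj? i l))

shape : ∀ {p} → Fin (5 + p) → Fin 6
shape zero                                = # 0
shape (suc zero)                          = # 1
shape (suc (suc zero))                    = # 2
shape (suc (suc (suc zero)))              = # 3
shape (suc (suc (suc (suc zero))))        = # 4
shape (suc (suc (suc (suc (suc _)))))     = # 5

-- The 5-cycle 0–1–2–3–4–0 together with p pendant vertices 5, …, 4 + p all attached to 0.
cycleWithPendants : ∀ p → Graph (5 + p)
cycleWithPendants p = preimage pan shape

next : Fin 5 → Fin 5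
next zero                             = # 1
next (suc zero)                       = # 2
next (suc (suc zero))                 = # 3
next (suc (suc (suc zero)))           = # 4
next (suc (suc (suc (suc zero))))     = # 0

rotate : ℕ → Fin 5 → Fin 5
rotate zero    s = s
rotate (suc r) s = next (rotate r s)

rotate-5 : ∀ s → rotate 5 s ≡ s
rotate-5 = from-yes (all? λ s → rotate 5 s ≟ s)

orbit : ∀ s i → i ≡ s ⊎ i ≡ rotate 1 s ⊎ i ≡ rotate 2 s ⊎ i ≡ rotate 3 s ⊎ i ≡ rotate 4 s
orbit = from-yes (all? λ s → all? λ i →
  i ≟ s ⊎-dec i ≟ rotate 1 s ⊎-dec i ≟ rotate 2 s ⊎-dec i ≟ rotate 3 s ⊎-dec i ≟ rotate 4 s)

module _ {p : ℕ} where

  private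
    G : Graph (5 + p)
    G = cycleWithPendants p

  cyc : Fin 5 → Fin (5 + p)
  cyc i = i ↑ˡ p

  data Position : Fin (5 + p) → Set where
    on-cycle : ∀ i → Position (cyc i)
    pendant  : ∀ j → Position (5 ↑ʳ j)

  position : ∀ v → Position v
  position zero                             = on-cycle (# 0)
  position (suc zero)                       = on-cycle (# 1)
  position (suc (suc zero))                 = on-cycle (# 2)
  position (suc (suc (suc zero)))           = on-cycle (# 3)
  position (suc (suc (suc (suc zero))))     = on-cycle (# 4)
  position (suc (suc (suc (suc (suc j)))))  = pendant j

  cycle-adjacent : ∀ i → Adj G (cyc i) (cyc (next i))
  cycle-adjacent zero                         = _
  cycle-adjacent (suc zero)                   = _
  cycle-adjacent (suc (suc zero))             = _
  cycle-adjacent (suc (suc (suc zero)))       = _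
  cycle-adjacent (suc (suc (suc (suc zero)))) = _

  cycle-adjacent⁻ : ∀ i → Adj G (cyc (next i)) (cyc i)
  cycle-adjacent⁻ i = symm G {cyc i} {cyc (next i)} (cycle-adjacent i)

  connected : Connected G
  connected = connected-via G zero toHub
    where
    toHub : ∀ v → Reachable G v zero
    toHub v with position v
    ... | pendant j                             = step _ here
    ... | on-cycle zero                         = here
    ... | on-cycle (suc zero)                   = step _ here
    ... | on-cycle (suc (suc zero))             = step {v = # 1} _ (step _ here)
    ... | on-cycle (suc (suc (suc zero)))       = step {v = # 4} _ (step _ here)
    ... | on-cycle (suc (suc (suc (suc zero)))) = step _ here

  cliqueNumber : IsCliqueNumber G 2
  cliqueNumber =
    (⁅ # 0 ⁆ ∪ ⁅ # 1 ⁆ , edge-isClique G {# 0} {# 1} _ ,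
     cong (2 +_) (trans (cong ∣_∣ (∪-identityˡ {p} ⊥)) (∣⊥∣≡0 p)))
    , clique≤2 G (λ u v w → pan-triangle-free (shape u) (shape v) (shape w))

  chromaticNumber≥3 : ∀ j → Colourable G j → 3 ≤ j
  chromaticNumber≥3 j colourable with 3 ≤? j
  ... | yes 3≤j = 3≤j
  ... | no  3≰j =
    let c , pc = colourable-mono G (≤-pred (≰⇒> 3≰j)) colourable
    in ⊥-elim (odd-cycle (c ∘ cyc) (λ i → pc _ _ (cycle-adjacent i)))
    where
    odd-cycle : (f : Fin 5 → Fin 2) → ¬ (∀ i → f i ≢ f (next i))
    odd-cycle f proper = proper (# 4)
      (trans (sym (alternate (proper (# 2)) (proper (# 3)))) (sym (alternate (proper (# 0)) (proper (# 1)))))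
      where
      alternate : ∀ {a b c : Fin 2} → a ≢ b → b ≢ c → a ≡ c
      alternate {a} {b} {c} = from-yes (all? λ (a : Fin 2) → all? λ b → all? λ c →
        ¬? (a ≟ b) →-dec ¬? (b ≟ c) →-dec a ≟ c) a b c

  cyc-∈ : ∀ {A : Subset 5} {B : Subset p} {i} → i ∈ A → cyc i ∈ A ++ B
  cyc-∈ {A} {B} {i} i∈A =
    lookup⇒[]= (cyc i) (A ++ B) (trans (lookup-++ˡ A B i) ([]=⇒lookup i∈A))

  pendant-∈ : ∀ {A : Subset 5} {j : Fin p} → 5 ↑ʳ j ∈ A ++ ⊤
  pendant-∈ {A} {j} = lookup⇒[]= (5 ↑ʳ j) (A ++ ⊤) (trans (lookup-++ʳ A ⊤ j) ([]=⇒lookup (∈⊤ {x = j})))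

-- A colour class of C₅ has at most two vertices, so some colour is used exactly once; a vertex s
-- carrying it differs in colour from both vertices at distance two. The lemma is checked by
-- exhaustive search and kept opaque so that the search is never unfolded where it is applied.
opaque
  uniquely-coloured-vertex : (f : Fin 5 → Fin 3) → (∀ i → f i ≢ f (next i)) →
    ∃ λ s → f s ≢ f (rotate 2 s) × f s ≢ f (rotate 3 s)
  uniquely-coloured-vertex = from-yes (all-colourings? resp λ f →
    all? (λ i → ¬? (f i ≟ f (next i))) →-dec
    any? λ s → ¬? (f s ≟ f (rotate 2 s)) ×-dec ¬? (f s ≟ f (rotate 3 s)))
    where
    resp : ∀ {f g : Fin 5 → Fin 3} → f ≗ g →
      ((∀ i → f i ≢ f (next i)) → ∃ λ s → f s ≢ f (rotate 2 s) × f s ≢ f (rotate 3 s)) →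
      ((∀ i → g i ≢ g (next i)) → ∃ λ s → g s ≢ g (rotate 2 s) × g s ≢ g (rotate 3 s))
    resp f≗g h g-proper =
      let s , s≢2 , s≢3 = h (λ i e → g-proper i (trans (sym (f≗g i)) (trans e (f≗g (next i)))))
      in s , (λ e → s≢2 (trans (f≗g s) (trans e (sym (f≗g _)))))
           , (λ e → s≢3 (trans (f≗g s) (trans e (sym (f≗g _)))))

pivotSet : Fin 5 → Subset 5
pivotSet s = ⁅ s ⁆ ∪ ⁅ rotate 2 s ⁆ ∪ ⁅ rotate 3 s ⁆

∣pivotSet∣ : ∀ s → ∣ pivotSet s ∣ ≡ 3
∣pivotSet∣ = from-yes (all? λ s → ∣ pivotSet s ∣ ≟ℕ 3)

pivotSet-members : ∀ s → s ∈ pivotSet s × rotate 2 s ∈ pivotSet s × rotate 3 s ∈ pivotSet s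
pivotSet-members = from-yes (all? λ s → s ∈? pivotSet s ×-dec rotate 2 s ∈? pivotSet s ×-dec rotate 3 s ∈? pivotSet s)

small-determining-set : ∀ p (c : Colouring (5 + p) 3) → Proper (cycleWithPendants p) c →
  ∃ λ D → Determining (cycleWithPendants p) c D × ∣ D ∣ ≤ 3 + p
small-determining-set p c pc with uniquely-coloured-vertex (c ∘ cyc) (λ i → pc _ _ (cycle-adjacent i))
... | s , s≢2 , s≢3 =
  D , determining-if-others-see-two-colours G pc cover ,
  ≤-reflexive (trans (∣++∣ (pivotSet s) ⊤) (cong₂ _+_ (∣pivotSet∣ s) (∣⊤∣≡n p)))
  where
  G : Graph (5 + p)
  G = cycleWithPendants p
  D : Subset (5 + p)
  D = pivotSet s ++ ⊤
  s∈ : cyc s ∈ D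
  s∈ = cyc-∈ (proj₁ (pivotSet-members s))
  s+2∈ : cyc (rotate 2 s) ∈ D
  s+2∈ = cyc-∈ (proj₁ (proj₂ (pivotSet-members s)))
  s+3∈ : cyc (rotate 3 s) ∈ D
  s+3∈ = cyc-∈ (proj₂ (proj₂ (pivotSet-members s)))
  cover : ∀ v → v ∈ D ⊎ SeesTwoColours G c D v
  cover v with position v
  ... | pendant j = inj₁ pendant-∈
  ... | on-cycle i with orbit s i
  ... | inj₁ refl                               = inj₁ s∈
  ... | inj₂ (inj₂ (inj₁ refl))                 = inj₁ s+2∈
  ... | inj₂ (inj₂ (inj₂ (inj₁ refl)))          = inj₁ s+3∈
  ... | inj₂ (inj₁ refl)                        = inj₂
    (cyc s , cyc (rotate 2 s) , s∈ , s+2∈ , cycle-adjacent⁻ s , cycle-adjacent {p} (rotate 1 s) , s≢2)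
  ... | inj₂ (inj₂ (inj₂ (inj₂ refl)))          = inj₂
    (cyc (rotate 3 s) , cyc s , s+3∈ , s∈ , cycle-adjacent⁻ (rotate 3 s) ,
     subst (λ t → Adj G (cyc (rotate 4 s)) (cyc t)) (rotate-5 s) (cycle-adjacent {p} (rotate 4 s)) ,
     s≢3 ∘ sym)

extremal extremal′ : Fin 6 → Fin 3
extremal  = lookup (# 0 ∷ # 1 ∷ # 0 ∷ # 1 ∷ # 2 ∷ # 1 ∷ [])
extremal′ = lookup (# 0 ∷ # 1 ∷ # 0 ∷ # 2 ∷ # 1 ∷ # 1 ∷ [])

colour-2-free-at : ∀ x → Dec (∀ w → Adj pan x w → extremal w ≢ # 2)
colour-2-free-at x = all? λ w → pan-adj? x w →-dec ¬? (extremal w ≟ # 2)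

module _ (p : ℕ) where

  private
    G : Graph (5 + p)
    G = cycleWithPendants p

  extremal-proper : Proper G (extremal ∘ shape)
  extremal-proper u v = from-yes (proper? pan pan-adj? extremal) (shape u) (shape v)

  lower-count : ∀ {S : Subset (5 + p)} → # 1 ∈ S → # 2 ∈ S → # 3 ∈ S ⊎ # 4 ∈ S →
    (∀ j → 5 ↑ʳ j ∈ S) → 3 + p ≤ ∣ S ∣
  lower-count {S} 1∈S 2∈S (inj₁ 3∈S) pendants∈S =
    subst (λ q → 3 + q ≤ ∣ S ∣) (∣⊤∣≡n p) (p⊆q⇒∣p∣≤∣q∣ T⊆S)
    where
    T⊆S : false ∷ true ∷ true ∷ true ∷ false ∷ ⊤ ⊆ S
    T⊆S (there here)                 = 1∈S
    T⊆S (there (there here))         = 2∈S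
    T⊆S (there (there (there here))) = 3∈S
    T⊆S {suc (suc (suc (suc (suc j))))} (there (there (there (there (there _))))) = pendants∈S j
  lower-count {S} 1∈S 2∈S (inj₂ 4∈S) pendants∈S =
    subst (λ q → 3 + q ≤ ∣ S ∣) (∣⊤∣≡n p) (p⊆q⇒∣p∣≤∣q∣ T⊆S)
    where
    T⊆S : false ∷ true ∷ true ∷ false ∷ true ∷ ⊤ ⊆ S
    T⊆S (there here)                         = 1∈S
    T⊆S (there (there here))                 = 2∈S
    T⊆S (there (there (there (there here)))) = 4∈S
    T⊆S {suc (suc (suc (suc (suc j))))} (there (there (there (there (there _))))) = pendants∈S j

  extremal′-proper : Proper G (extremal′ ∘ shape)
  extremal′-proper u v = from-yes (proper? pan pan-adj? extremal′) (shape u) (shape v)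

  extremal′-agrees-off-3-4 : ∀ (v : Fin (5 + p)) → v ∉ ⁅ # 3 ⁆ ∪ ⁅ # 4 ⁆ → extremal′ (shape v) ≡ extremal (shape v)
  extremal′-agrees-off-3-4 v v∉ with position v
  ... | pendant j                             = refl
  ... | on-cycle zero                         = refl
  ... | on-cycle (suc zero)                   = refl
  ... | on-cycle (suc (suc zero))             = refl
  ... | on-cycle (suc (suc (suc zero)))       = ⊥-elim (v∉ (there (there (there here))))
  ... | on-cycle (suc (suc (suc (suc zero)))) = ⊥-elim (v∉ (there (there (there (there here)))))

  extremal-lower : ∀ S → Determining G (extremal ∘ shape) S → 3 + p ≤ ∣ S ∣
  extremal-lower S det
    with determining-meets G {D = ⁅ # 3 ⁆ ∪ ⁅ # 4 ⁆} {w = # 3} det extremal′-proper extremal′-agrees-off-3-4 (λ ())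
  ... | x , x∈S , x∈⁅3⁆∪⁅4⁆ = lower-count (free (# 1) (λ ())) (free (# 2) (λ ())) 3or4∈S (λ j → free (5 ↑ʳ j) (λ ()))
    where
    free : ∀ v → # 2 ≢ extremal (shape v) → {True (colour-2-free-at (shape v))} → v ∈ S
    free v 2≢ {2-free} = recolourable-∈ G extremal-proper 2≢ (λ u → toWitness 2-free (shape u)) det
    3or4∈S : # 3 ∈ S ⊎ # 4 ∈ S
    3or4∈S with x∈p∪q⁻ ⁅ # 3 ⁆ ⁅ # 4 ⁆ x∈⁅3⁆∪⁅4⁆
    ... | inj₁ x∈⁅3⁆ = inj₁ (subst (_∈ S) (x∈⁅y⁆⇒x≡y _ x∈⁅3⁆) x∈S)
    ... | inj₂ x∈⁅4⁆ = inj₂ (subst (_∈ S) (x∈⁅y⁆⇒x≡y _ x∈⁅4⁆) x∈S)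

  maxSCS : IsMaxSCS G 3 (3 + p)
  maxSCS = isMaxSCS-intro G (λ u v → pan-adj? (shape u) (shape v))
    (extremal ∘ shape) extremal-proper extremal-lower (small-determining-set p)

mainTheorem5 : ∀ (m : ℕ) → Σ ℕ λ n → m ≤ n × Σ (Graph n) λ G → Connected G × Σ ℕ λ w → Σ ℕ λ k → IsCliqueNumber G w × IsChromaticNumber G k × w < k × IsMaxSCS G k (n ∸ 2)
mainTheorem5 m =
  5 + m , m≤n+m m 5 , cycleWithPendants m , connected , 2 , 3 , cliqueNumber ,
  ((extremal ∘ shape , extremal-proper m) , chromaticNumber≥3) , ≤-refl , maxSCS m
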